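{- Let $L$ be a lattice with canonical extension $L^\delta$. If $k\in K(L^\delta)$ is finitely prime and $o=\bigvee\{b\in L \mid b\not\geq k\}$ (join taken in $L^\delta$), then $k\not\leq o$.
   Context: For a (bounded) lattice $L$, the canonical extension $L^\delta$ is a complete lattice containing $L$ as a sublattice such that (denseness) every element of $L^\delta$ is a join of meets of elements of $L$ and also a meet of joins of elements of $L$, and (compactness) whenever $S,T\subseteq L$ satisfy $\bigwedge S\leq\bigvee T$ in $L^\delta$, there are finite $S'\subseteq S$, $T'\subseteq T$ with $\bigwedge S'\leq \bigvee T'$. It is unique up to isomorphism fixing $L$. $K(L^\delta)$ denotes the set of closed elements, i.e. elements of $L^\delta$ that are meets of subsets of $L$. An element $u\in L^\delta$ is finitely prime if $u\neq\bot$ and for all $v,w\in L^\delta$, $u\leq v\vee w$ implies $u\leq v$ or $u\leq w$. -}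

module Defs where

open import Level using (Level; suc)
open import Function using (_∘_)
open import Relation.Binary.Lattice.Bundles using (BoundedLattice)
open import Relation.Unary using (Pred)
open import Relation.Nullary using (¬_)
open import Data.Product using (Σ; ∃; _×_; proj₁)
open import Data.Sum using (_⊎_)
open import Data.List using (List)
open import Data.List.Relation.Unary.All using (All)
open import Data.List.Membership.Propositional renaming (_∈_ to _∈ₗ_)

-- A complete lattice: a bounded lattice with joins and meets of all
-- families indexed by types in Set ℓ (= all subsets of the carrier,
-- since the carrier itself lives in Set ℓ).
record CompleteLattice (ℓ : Level) : Set (suc ℓ) where
  field
    boundedLattice : BoundedLattice ℓ ℓ ℓ
  open BoundedLattice boundedLattice public
  field
    ⋁       : {I : Set ℓ} → (I → Carrier) → Carrier
    ⋁-upper : {I : Set ℓ} (f : I → Carrier) (i : I) → f i ≤ ⋁ f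
    ⋁-least : {I : Set ℓ} (f : I → Carrier) (x : Carrier) → ((i : I) → f i ≤ x) → ⋁ f ≤ x
    ⋀       : {I : Set ℓ} → (I → Carrier) → Carrier
    ⋀-lower : {I : Set ℓ} (f : I → Carrier) (i : I) → ⋀ f ≤ f i
    ⋀-great : {I : Set ℓ} (f : I → Carrier) (x : Carrier) → ((i : I) → x ≤ f i) → x ≤ ⋀ f

record CanonicalExtension {ℓ : Level} (L : BoundedLattice ℓ ℓ ℓ) : Set (suc ℓ) where
  module L = BoundedLattice L
  field
    Lδ : CompleteLattice ℓ
  open CompleteLattice Lδ public
  field
    e      : L.Carrier → Carrier
    e-cong : ∀ {a b} → a L.≈ b → e a ≈ e b
    e-inj  : ∀ {a b} → e a ≈ e b → a L.≈ b
    e-∨    : ∀ a b → e (a L.∨ b) ≈ e a ∨ e b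
    e-∧    : ∀ a b → e (a L.∧ b) ≈ e a ∧ e b
    e-⊤    : e L.⊤ ≈ ⊤
    e-⊥    : e L.⊥ ≈ ⊥
    dense-⋁⋀ : (x : Carrier) → Σ (Set ℓ) λ I → Σ (I → Set ℓ) λ J →
               Σ ((i : I) → J i → L.Carrier) λ f → x ≈ ⋁ (λ i → ⋀ (λ j → e (f i j)))
    dense-⋀⋁ : (x : Carrier) → Σ (Set ℓ) λ I → Σ (I → Set ℓ) λ J →
               Σ ((i : I) → J i → L.Carrier) λ f → x ≈ ⋀ (λ i → ⋁ (λ j → e (f i j)))
    compact : (S T : Pred L.Carrier ℓ) →
              ⋀ {Σ L.Carrier S} (e ∘ proj₁) ≤ ⋁ {Σ L.Carrier T} (e ∘ proj₁) →
              Σ (List L.Carrier) λ S′ → Σ (List L.Carrier) λ T′ →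
                All S S′ × All T T′ ×
                (⋀ {Σ L.Carrier (_∈ₗ S′)} (e ∘ proj₁) ≤ ⋁ {Σ L.Carrier (_∈ₗ T′)} (e ∘ proj₁))

  IsClosed : Carrier → Set (suc ℓ)
  IsClosed x = Σ (Pred L.Carrier ℓ) λ S → x ≈ ⋀ {Σ L.Carrier S} (e ∘ proj₁)

  FinitelyPrime : Carrier → Set ℓ
  FinitelyPrime u = (¬ (u ≈ ⊥)) × ((v w : Carrier) → u ≤ v ∨ w → (u ≤ v) ⊎ (u ≤ w))

  oOf : Carrier → Carrier
  oOf k = ⋁ {Σ L.Carrier (λ b → ¬ (k ≤ e b))} (e ∘ proj₁)

-- Since k is closed, k ≤ o is an inequality between a meet and a join of
-- elements of L, so by compactness a finite meet of elements above k lies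
-- below a finite join b₁ ∨ … ∨ bₙ of elements with k ≰ bᵢ. Then
-- k ≤ b₁ ∨ … ∨ bₙ, and since k is finitely prime (in particular k ≠ ⊥)
-- it must lie below some bᵢ, a contradiction.
module Submission where

open import Defs
open import Level using (Level)
open import Relation.Binary.Lattice.Bundles using (BoundedLattice)
open import Relation.Nullary using (¬_)
open import Data.Product using (Σ; _,_; proj₁)
open import Data.Sum using (inj₁; inj₂)
open import Data.List using (List; []; _∷_)
open import Data.List.Relation.Unary.All using (All; []; _∷_; lookup)
open import Data.List.Relation.Unary.Any using (here; there)
open import Data.List.Membership.Propositional renaming (_∈_ to _∈ₗ_)
open import Relation.Binary.PropositionalEquality using (refl)
open import Relation.Unary using (Pred)
open import Function using (_∘_)

module _ {ℓ : Level} {L : BoundedLattice ℓ ℓ ℓ} (E : CanonicalExtension L) where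
  open CanonicalExtension E

  ⋁ₗ ⋀ₗ : List L.Carrier → Carrier
  ⋁ₗ bs = ⋁ {Σ L.Carrier (_∈ₗ bs)} (e ∘ proj₁)
  ⋀ₗ bs = ⋀ {Σ L.Carrier (_∈ₗ bs)} (e ∘ proj₁)

  ⋁ₗ-[]≤⊥ : ⋁ₗ [] ≤ ⊥
  ⋁ₗ-[]≤⊥ = ⋁-least _ ⊥ λ ()

  ⋁ₗ-∷≤∨ : ∀ b bs → ⋁ₗ (b ∷ bs) ≤ e b ∨ ⋁ₗ bs
  ⋁ₗ-∷≤∨ b bs = ⋁-least _ _ λ
    { (_ , here refl) → x≤x∨y _ _
    ; (x , there x∈bs) → trans (⋁-upper _ (x , x∈bs)) (y≤x∨y _ _)
    }

  finitelyPrime-≰-⋁ₗ : ∀ {k} → FinitelyPrime k → ∀ bs →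
                       All (λ b → ¬ (k ≤ e b)) bs → ¬ (k ≤ ⋁ₗ bs)
  finitelyPrime-≰-⋁ₗ (k≉⊥ , _) [] [] k≤⊥ =
    k≉⊥ (antisym (trans k≤⊥ ⋁ₗ-[]≤⊥) (minimum _))
  finitelyPrime-≰-⋁ₗ fp@(_ , prime) (b ∷ bs) (k≰b ∷ k≰bs) k≤⋁
    with prime (e b) (⋁ₗ bs) (trans k≤⋁ (⋁ₗ-∷≤∨ b bs))
  ... | inj₁ k≤b  = k≰b k≤b
  ... | inj₂ k≤bs = finitelyPrime-≰-⋁ₗ fp bs k≰bs k≤bs

  ⋀-≤-⋀ₗ-sublist : (S : Pred L.Carrier ℓ) (as : List L.Carrier) → All S as →
                   ⋀ {Σ L.Carrier S} (e ∘ proj₁) ≤ ⋀ₗ as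
  ⋀-≤-⋀ₗ-sublist S as as⊆S =
    ⋀-great _ _ λ { (a , a∈as) → ⋀-lower _ (a , lookup as⊆S a∈as) }

  closed-finitelyPrime-≰-oOf : ∀ {k} → IsClosed k → FinitelyPrime k → ¬ (k ≤ oOf k)
  closed-finitelyPrime-≰-oOf {k} (S , k≈⋀S) fp k≤o
    with compact S (λ b → ¬ (k ≤ e b)) (trans (reflexive (Eq.sym k≈⋀S)) k≤o)
  ... | as , bs , as⊆S , k≰bs , ⋀as≤⋁bs =
    finitelyPrime-≰-⋁ₗ fp bs k≰bs
      (trans (reflexive k≈⋀S) (trans (⋀-≤-⋀ₗ-sublist S as as⊆S) ⋀as≤⋁bs))

lemma2p3 : {ℓ : Level} (L : BoundedLattice ℓ ℓ ℓ) (E : CanonicalExtension L)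
    → (k : CanonicalExtension.Carrier E)
    → CanonicalExtension.IsClosed E k
    → CanonicalExtension.FinitelyPrime E k
    → ¬ (CanonicalExtension._≤_ E k (CanonicalExtension.oOf E k))
lemma2p3 L E k = closed-finitelyPrime-≰-oOf E
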